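{- Let $f(p_1,\ldots,p_n)$ be a Boolean function. Then: 1. If $f$ is non-constant monotone, it is expressible as $F(p_1,\ldots,p_n)$ where $F$ is a superposition of $\wedge$'s and $\vee$'s. 2. If $f$ is non-constant monotone, then $f(p_1,\ldots,p_1)$ is equivalent to $p_1$. 3. If $f$ is non-constant anti-monotone, it is expressible as $\neg F(p_1,\ldots,p_n)$ where $F$ is a superposition of $\wedge$'s and $\vee$'s. 4. If $f$ is non-constant anti-monotone, then $f(p_1,\ldots,p_1)$ is equivalent to $\neg p_1$. 5. If $f$ is a TFT-function, then for some $A_1,\ldots,A_n\in\{p_1,p_2,p_1\vee p_2,\bot,\top\}$, $f(A_1,\ldots,A_n)$ is equivalent to $p_1\to p_2$. 6. If $f$ is an FTF-function, then for some $A_1,\ldots,A_n\in\{p_1,p_2,p_1\wedge p_2,\bot,\top\}$, $f(A_1,\ldots,A_n)$ is equivalent to $p_1\wedge\neg p_2$. 7. If $f$ is a rest function, then for some $B_1,\ldots,B_n,C_1,\ldots,C_n\in\{p_1,\bot,\top\}$, $f(B_1,\ldots,B_n)$ is equivalent to $p_1$ and $f(C_1,\ldots,C_n)$ is equivalent to $\neg p_1$. 8. If $f$ is non-constant and not FTF, then $f$ is equivalent to a formula $(p^1_1\wedge\cdots\wedge p^1_{i_1})\vee\cdots\vee(p^k_1\wedge\cdots\wedge p^k_{i_k})\vee(\neg q^1_1\wedge\cdots\wedge\neg q^1_{j_1})\vee\cdots\vee(\neg q^m_1\wedge\cdots\wedge\neg q^m_{j_m})$ with $m,k\ge0$, $m+k>0$,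 $i_1,\ldots,i_k,j_1,\ldots,j_m>0$, and all $p^g_h,q^g_h\in\{p_1,\ldots,p_n\}$. 9. If $f$ is non-constant and not TFT, then $f$ is equivalent to a formula $(p^1_1\vee\cdots\vee p^1_{i_1})\wedge\cdots\wedge(p^k_1\vee\cdots\vee p^k_{i_k})\wedge(\neg q^1_1\vee\cdots\vee\neg q^1_{j_1})\wedge\cdots\wedge(\neg q^m_1\vee\cdots\vee\neg q^m_{j_m})$ with $m,k\ge0$, $m+k>0$, $i_1,\ldots,i_k,j_1,\ldots,j_m>0$, and all $p^g_h,q^g_h\in\{p_1,\ldots,p_n\}$.
   Context: Tuples of truth values are ordered componentwise, with $0<1$. A Boolean function $f$ is monotone if $\bar a\le\bar b\Rightarrow f(\bar a)\le f(\bar b)$; anti-monotone if $\bar a\le\bar b\Rightarrow f(\bar a)\ge f(\bar b)$ (constants are both); a rest function if it is neither monotone nor anti-monotone; a TFT-function if there are tuples $\bar a<\bar b<\bar c$ with $f(\bar a)=f(\bar c)=1$ and $f(\bar b)=0$; an FTF-function if there are tuples $\bar a<\bar b<\bar c$ with $f(\bar a)=f(\bar c)=0$ and $f(\bar b)=1$. "Equivalent" means equivalent as classical propositional formulas. -}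

module Defs where

open import Data.Bool using (Bool; true; false; not; _∧_; _∨_) renaming (_≤_ to _≤ᵇ_)
open import Data.Nat using (ℕ; zero; suc; _+_; _<_)
open import Data.Fin using (Fin)
open import Data.Vec using (Vec; []; _∷_; map; lookup; replicate)
open import Data.Vec.Relation.Binary.Pointwise.Inductive using (Pointwise)
open import Data.List using (List; []; _∷_; length)
open import Data.List.NonEmpty using (List⁺)
open import Data.List.Membership.Propositional using (_∈_)
open import Data.Vec.Relation.Unary.All using (All)
open import Data.Product using (Σ; ∃; _×_; _,_)
open import Relation.Binary.PropositionalEquality using (_≡_; _≢_)
open import Relation.Nullary using (¬_)

BoolFun : ℕ → Set
BoolFun n = Vec Bool n → Bool

_≤ₜ_ : ∀ {n} → Vec Bool n → Vec Bool n → Set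
_≤ₜ_ = Pointwise _≤ᵇ_

_<ₜ_ : ∀ {n} → Vec Bool n → Vec Bool n → Set
a <ₜ b = (a ≤ₜ b) × (a ≢ b)

Monotone : ∀ {n} → BoolFun n → Set
Monotone f = ∀ a b → a ≤ₜ b → f a ≤ᵇ f b

AntiMonotone : ∀ {n} → BoolFun n → Set
AntiMonotone f = ∀ a b → a ≤ₜ b → f b ≤ᵇ f a

Constant : ∀ {n} → BoolFun n → Set
Constant f = ∀ a b → f a ≡ f b

NonConstant : ∀ {n} → BoolFun n → Set
NonConstant f = ¬ Constant f

Rest : ∀ {n} → BoolFun n → Set
Rest f = ¬ Monotone f × ¬ AntiMonotone f

TFT : ∀ {n} → BoolFun n → Set
TFT {n} f = Σ (Vec Bool n) λ a → Σ (Vec Bool n) λ b → Σ (Vec Bool n) λ c →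
  a <ₜ b × b <ₜ c × f a ≡ true × f b ≡ false × f c ≡ true

FTF : ∀ {n} → BoolFun n → Set
FTF {n} f = Σ (Vec Bool n) λ a → Σ (Vec Bool n) λ b → Σ (Vec Bool n) λ c →
  a <ₜ b × b <ₜ c × f a ≡ false × f b ≡ true × f c ≡ false

data Form (V : Set) : Set where
  var  : V → Form V
  ⊥f   : Form V
  ⊤f   : Form V
  ¬f_  : Form V → Form V
  _∧f_ : Form V → Form V → Form V
  _∨f_ : Form V → Form V → Form V
  _⇒f_ : Form V → Form V → Form V

⟦_⟧ : ∀ {V} → Form V → (V → Bool) → Bool
⟦ var x ⟧ v = v x
⟦ ⊥f ⟧ v = false
⟦ ⊤f ⟧ v = true
⟦ ¬f A ⟧ v = not (⟦ A ⟧ v)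
⟦ A ∧f B ⟧ v = ⟦ A ⟧ v ∧ ⟦ B ⟧ v
⟦ A ∨f B ⟧ v = ⟦ A ⟧ v ∨ ⟦ B ⟧ v
⟦ A ⇒f B ⟧ v = not (⟦ A ⟧ v) ∨ ⟦ B ⟧ v

data AndOr {V : Set} : Form V → Set where
  var : ∀ x → AndOr (var x)
  and : ∀ {A B} → AndOr A → AndOr B → AndOr (A ∧f B)
  or  : ∀ {A B} → AndOr A → AndOr B → AndOr (A ∨f B)

-- propositional variables p₁, p₂ (variables are ℕ, p_{i+1} = var i)
p₁ p₂ : Form ℕ
p₁ = var 0
p₂ = var 1

_[_] : ∀ {n V} → BoolFun n → Vec (Form V) n → (V → Bool) → Bool
(f [ As ]) v = f (map (λ A → ⟦ A ⟧ v) As)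

_≅_ : ∀ {V} → ((V → Bool) → Bool) → Form V → Set
g ≅ B = ∀ v → g v ≡ ⟦ B ⟧ v

_≈F_ : ∀ {n} → BoolFun n → Form (Fin n) → Set
f ≈F F = ∀ a → f a ≡ ⟦ F ⟧ (lookup a)

-- formula shapes of items 8 and 9: a list of positive conjunctions (resp. disjunctions)
-- and a list of negative ones, each non-empty, built as formulas
module _ {V : Set} where
  open Data.List.NonEmpty using (_∷_)

  bigOp' : (Form V → Form V → Form V) → Form V → List (Form V) → Form V
  bigOp' _∘_ A []       = A
  bigOp' _∘_ A (B ∷ Bs) = A ∘ bigOp' _∘_ B Bs

  bigOp : (Form V → Form V → Form V) → List⁺ (Form V) → Form V
  bigOp _∘_ (A ∷ As) = bigOp' _∘_ A As

  posLits : List⁺ V → List⁺ (Form V)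
  posLits = Data.List.NonEmpty.map var

  negLits : List⁺ V → List⁺ (Form V)
  negLits = Data.List.NonEmpty.map (λ x → ¬f var x)

  mapL : ∀ {A B : Set} → (A → B) → List A → List B
  mapL = Data.List.map

  -- the formula shape (C₁ ∘ … ∘ C_{k+m}); the ⊥f case (k + m = 0) is excluded
  -- by the hypothesis k + m > 0 in the statement
  shape : (Form V → Form V → Form V) → (Form V → Form V → Form V)
        → List (List⁺ V) → List (List⁺ V) → Form V
  shape outerOp innerOp ps qs with mapL (λ c → bigOp innerOp (posLits c)) ps
                                    Data.List.++ mapL (λ c → bigOp innerOp (negLits c)) qs
  ... | []     = ⊥f
  ... | A ∷ As = bigOp outerOp (A ∷ As)

  DNFshape CNFshape : List (List⁺ V) → List (List⁺ V) → Form V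
  DNFshape = shape _∨f_ _∧f_
  CNFshape = shape _∧f_ _∨f_

¬FTF ¬TFT : ∀ {n} → BoolFun n → Set
¬FTF f = ¬ FTF f
¬TFT f = ¬ TFT f

-- If f has no FTF pattern, every true point a is up-closed (all points above a are
-- true) or down-closed (all points below a are true): otherwise false points below
-- and above a would form an FTF pattern. Hence f is true exactly at the points lying
-- above an up-closed point x or below a down-closed point x, i.e. f is the disjunction
-- of the conjunctions of the p_i with x_i = 1, resp. of the ¬p_i with x_i = 0. For a
-- monotone non-constant f no point is down-closed, so this DNF is positive; the CNF
-- and the anti-monotone forms follow by applying this to ¬f. For items 5-7, along a
-- chain a ≤ b ≤ c every coordinate column is 000, 001, 011 or 111; substituting
-- ⊥, X, Y, ⊤ for these (with X → Y valid) turns the tuple into c, b or a according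
-- as X holds, only Y holds, or neither.

module Submission where

open import Defs
open import Data.Bool using (Bool; true; false; not; _∧_; _∨_; if_then_else_; f≤t; b≤b)
  renaming (_≤_ to _≤ᵇ_)
import Data.Bool.Properties as Boolₚ
open import Data.Nat using (ℕ; _+_; _<_; z≤n; s≤s)
open import Data.Nat.Properties using (+-comm; +-identityʳ)
open import Data.Fin using (Fin; zero; suc)
open import Data.Vec using (Vec; []; _∷_; map; lookup; replicate)
open import Data.Vec.Properties using (map-replicate)
import Data.Vec.Relation.Binary.Pointwise.Inductive as Pointwise
open Pointwise using ([]; _∷_)
open import Data.Vec.Relation.Unary.All using (All; []; _∷_)
open import Data.List using (List; []; _∷_; length; _++_; filter; mapMaybe)
  renaming (map to mapˡ)
open import Data.List.NonEmpty using (List⁺; _∷_; toList; fromList)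
open import Data.List.Relation.Unary.Any using (Any; here; there; satisfied)
import Data.List.Relation.Unary.Any as Any
import Data.List.Relation.Unary.Any.Properties as Anyₚ
open import Data.List.Relation.Unary.All using ([]; _∷_) renaming (All to Allˡ)
import Data.List.Relation.Unary.All as Allˡ
import Data.List.Relation.Unary.All.Properties as Allˡₚ
open import Data.List.Membership.Propositional using (_∈_; find; lose)
open import Data.List.Membership.Propositional.Properties
  using (∈-map⁺; ∈-++⁺ˡ; ∈-++⁺ʳ; ∈-filter⁺; ∈-filter⁻)
open import Data.List.Properties using (filter-none)
open import Data.Product using (Σ; ∃; ∃₂; _×_; _,_; proj₂)
open import Data.Sum using (_⊎_; inj₁; inj₂; [_,_]′) renaming (swap to ⊎-swap)
open import Data.Sum.Function.Propositional using (_⊎-⇔_)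
open import Function using (_∘_; id; _⇔_; mk⇔; Equivalence)
open import Function.Properties.Equivalence using () renaming (trans to ⇔-trans; sym to ⇔-sym)
open import Function.Properties.Inverse using (↔⇒⇔)
open import Relation.Binary.PropositionalEquality using (_≡_; _≢_; refl; sym; trans; cong; cong₂; subst; subst₂)
open import Relation.Nullary using (¬_; Dec; yes; no; contradiction)
open import Relation.Nullary.Decidable using (map′; _→-dec_)
open import Relation.Unary using (Decidable)

open Equivalence using (to; from)

private variable
  n : ℕ
  V : Set

not-≡⇔ : ∀ {x y} → not x ≡ y ⇔ x ≡ not y
not-≡⇔ {x} {y} = mk⇔ (λ { refl → sym (Boolₚ.not-involutive x) }) (λ { refl → Boolₚ.not-involutive y })

∨-≡-true : ∀ {x y} → x ∨ y ≡ true ⇔ (x ≡ true ⊎ y ≡ true)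
∨-≡-true {true}  = mk⇔ (λ _ → inj₁ refl) (λ _ → refl)
∨-≡-true {false} = mk⇔ inj₂ (λ { (inj₁ ()) ; (inj₂ e) → e })

∧-≡-false : ∀ {x y} → x ∧ y ≡ false ⇔ (x ≡ false ⊎ y ≡ false)
∧-≡-false {false} = mk⇔ (λ _ → inj₁ refl) (λ _ → refl)
∧-≡-false {true}  = mk⇔ inj₂ (λ { (inj₁ ()) ; (inj₂ e) → e })

∧-≡-true : ∀ {x y} → x ∧ y ≡ true ⇔ (x ≡ true × y ≡ true)
∧-≡-true {true}  = mk⇔ (refl ,_) proj₂
∧-≡-true {false} = mk⇔ (λ ()) (λ ())

∨-≡-false : ∀ {x y} → x ∨ y ≡ false ⇔ (x ≡ false × y ≡ false)
∨-≡-false {false} = mk⇔ (refl ,_) proj₂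
∨-≡-false {true}  = mk⇔ (λ ()) (λ ())

not-antitone : ∀ {x y} → x ≤ᵇ y → not y ≤ᵇ not x
not-antitone f≤t = f≤t
not-antitone b≤b = b≤b

≰ᵇ⇒ : ∀ {x y} → ¬ x ≤ᵇ y → x ≡ true × y ≡ false
≰ᵇ⇒ {true}  {false} _   = refl , refl
≰ᵇ⇒ {true}  {true}  x≰y = contradiction b≤b x≰y
≰ᵇ⇒ {false} {y}     x≰y = contradiction (Boolₚ.≤-minimum y) x≰y

true≤⇒ : ∀ {x} → true ≤ᵇ x → x ≡ true
true≤⇒ b≤b = refl

≤false⇒ : ∀ {x} → x ≤ᵇ false → x ≡ false
≤false⇒ b≤b = refl

y≤x∨y : ∀ x y → y ≤ᵇ x ∨ y
y≤x∨y true  y = Boolₚ.≤-maximum y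
y≤x∨y false y = Boolₚ.≤-refl

x∧y≤x : ∀ x y → x ∧ y ≤ᵇ x
x∧y≤x true  y = Boolₚ.≤-maximum y
x∧y≤x false y = b≤b

¬→⇒ : {A B : Set} → Dec A → ¬ (A → B) → A × ¬ B
¬→⇒ (yes a) ¬a→b = a , λ b → ¬a→b λ _ → b
¬→⇒ (no ¬a) ¬a→b = contradiction (λ a → contradiction a ¬a) ¬a→b

-- Exhaustive quantification over tuples

allTuples : ∀ n → List (Vec Bool n)
allTuples ℕ.zero    = [] ∷ []
allTuples (ℕ.suc n) = mapˡ (false ∷_) (allTuples n) ++ mapˡ (true ∷_) (allTuples n)

∈-allTuples : (x : Vec Bool n) → x ∈ allTuples n
∈-allTuples []          = here refl
∈-allTuples (false ∷ x) = ∈-++⁺ˡ (∈-map⁺ (false ∷_) (∈-allTuples x))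
∈-allTuples (true ∷ x)  = ∈-++⁺ʳ _ (∈-map⁺ (true ∷_) (∈-allTuples x))

∀-tuples? : {P : Vec Bool n → Set} → Decidable P → Dec (∀ x → P x)
∀-tuples? P? = map′ (λ all x → Allˡ.lookup all (∈-allTuples x)) (λ ∀P → Allˡ.tabulate λ {x} _ → ∀P x)
                     (Allˡ.all? P? _)

¬∀⇒∃¬ : {P : Vec Bool n → Set} → Decidable P → ¬ (∀ x → P x) → ∃ λ x → ¬ P x
¬∀⇒∃¬ P? ¬∀P = satisfied (Allˡₚ.¬All⇒Any¬ P? _ λ all → ¬∀P λ x → Allˡ.lookup all (∈-allTuples x))

Any-filter-allTuples : {P Q : Vec Bool n → Set} (P? : Decidable P) →
                       Any Q (filter P? (allTuples n)) ⇔ ∃ λ x → P x × Q x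
Any-filter-allTuples P? = mk⇔
  (λ any → let x , x∈ , qx = find any in x , proj₂ (∈-filter⁻ P? {xs = allTuples _} x∈) , qx)
  (λ (x , px , qx) → lose (∈-filter⁺ P? {xs = allTuples _} (∈-allTuples x) px) qx)

≤ₜ-refl : {a : Vec Bool n} → a ≤ₜ a
≤ₜ-refl = Pointwise.refl Boolₚ.≤-refl

_≤ₜ?_ : (a b : Vec Bool n) → Dec (a ≤ₜ b)
_≤ₜ?_ = Pointwise.decidable Boolₚ._≤?_

falses-≤ₜ : (a : Vec Bool n) → replicate n false ≤ₜ a
falses-≤ₜ []      = []
falses-≤ₜ (x ∷ a) = Boolₚ.≤-minimum x ∷ falses-≤ₜ a

≤ₜ-trues : (a : Vec Bool n) → a ≤ₜ replicate n true
≤ₜ-trues []      = []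
≤ₜ-trues (x ∷ a) = Boolₚ.≤-maximum x ∷ ≤ₜ-trues a

module _ (f : BoolFun n) where

  constant : ∀ β → (∀ a → f a ≡ β) → Constant f
  constant β fβ a b = trans (fβ a) (sym (fβ b))

  nonConstant⇒true : NonConstant f → ∃ λ a → f a ≡ true
  nonConstant⇒true nc =
    let a , fa≢false = ¬∀⇒∃¬ (λ a → f a Boolₚ.≟ false) (nc ∘ constant false)
    in a , Boolₚ.¬-not fa≢false

  nonConstant-not : NonConstant f → NonConstant (not ∘ f)
  nonConstant-not nc c = nc λ a b → Boolₚ.not-injective (c a b)

  antiMonotone⇒monotone-not : AntiMonotone f → Monotone (not ∘ f)
  antiMonotone⇒monotone-not anti a b a≤b = not-antitone (anti a b a≤b)

  monotone-not⇒antiMonotone : Monotone (not ∘ f) → AntiMonotone f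
  monotone-not⇒antiMonotone mono a b a≤b =
    subst₂ _≤ᵇ_ (Boolₚ.not-involutive (f b)) (Boolₚ.not-involutive (f a)) (not-antitone (mono a b a≤b))

  ¬TFT⇒¬FTF-not : ¬TFT f → ¬FTF (not ∘ f)
  ¬TFT⇒¬FTF-not ¬tft (a , b , c , a<b , b<c , fa , fb , fc) =
    ¬tft (a , b , c , a<b , b<c , to not-≡⇔ fa , to not-≡⇔ fb , to not-≡⇔ fc)

  monotone⇒¬FTF : Monotone f → ¬FTF f
  monotone⇒¬FTF mono (_ , b , c , _ , (b≤c , _) , _ , fb , fc) with subst₂ _≤ᵇ_ fb fc (mono b c b≤c)
  ... | ()

  monotone-falses : Monotone f → NonConstant f → f (replicate n false) ≡ false
  monotone-falses mono nc with f (replicate n false) in f⊥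
  ... | false = refl
  ... | true  = contradiction
    (constant true λ a → true≤⇒ (subst (_≤ᵇ f a) f⊥ (mono _ a (falses-≤ₜ a)))) nc

  monotone-trues : Monotone f → NonConstant f → f (replicate n true) ≡ true
  monotone-trues mono nc with f (replicate n true) in f⊤
  ... | true  = refl
  ... | false = contradiction
    (constant false λ a → ≤false⇒ (subst (f a ≤ᵇ_) f⊤ (mono a _ (≤ₜ-trues a)))) nc

  ¬monotone⇒witness : ¬ Monotone f → ∃₂ λ a b → a ≤ₜ b × f a ≡ true × f b ≡ false
  ¬monotone⇒witness ¬mono =
    let a , ¬mono-a  = ¬∀⇒∃¬ (λ a → ∀-tuples? (monotoneAt? a)) ¬mono
        b , ¬mono-ab = ¬∀⇒∃¬ (monotoneAt? a) ¬mono-a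
        a≤b , fa≰fb  = ¬→⇒ (a ≤ₜ? b) ¬mono-ab
    in a , b , a≤b , ≰ᵇ⇒ fa≰fb
    where
    monotoneAt? : ∀ a b → Dec (a ≤ₜ b → f a ≤ᵇ f b)
    monotoneAt? a b = (a ≤ₜ? b) →-dec (f a Boolₚ.≤? f b)

¬antiMonotone⇒witness : (f : BoolFun n) → ¬ AntiMonotone f →
                        ∃₂ λ a b → a ≤ₜ b × f a ≡ false × f b ≡ true
¬antiMonotone⇒witness f ¬anti =
  let a , b , a≤b , ¬fa , ¬fb = ¬monotone⇒witness (not ∘ f) (¬anti ∘ monotone-not⇒antiMonotone f)
  in a , b , a≤b , to not-≡⇔ ¬fa , to not-≡⇔ ¬fb

module _ (f : BoolFun n) where

  UpTrue DownTrue : Vec Bool n → Set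
  UpTrue   x = ∀ y → x ≤ₜ y → f y ≡ true
  DownTrue x = ∀ y → y ≤ₜ x → f y ≡ true

  UpTrue? : Decidable UpTrue
  UpTrue? x = ∀-tuples? λ y → (x ≤ₜ? y) →-dec (f y Boolₚ.≟ true)

  DownTrue? : Decidable DownTrue
  DownTrue? x = ∀-tuples? λ y → (y ≤ₜ? x) →-dec (f y Boolₚ.≟ true)

  ¬∀true⇒false : {R : Vec Bool n → Set} → Decidable R → ¬ (∀ y → R y → f y ≡ true) →
                 ∃ λ y → R y × f y ≡ false
  ¬∀true⇒false R? ¬∀ =
    let y , ¬[Ry→fy] = ¬∀⇒∃¬ (λ y → R? y →-dec (f y Boolₚ.≟ true)) ¬∀
        Ry , fy≢true = ¬→⇒ (R? y) ¬[Ry→fy]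
    in y , Ry , Boolₚ.¬-not fy≢true

  ¬FTF⇒UpTrue⊎DownTrue : ¬FTF f → ∀ a → f a ≡ true → UpTrue a ⊎ DownTrue a
  ¬FTF⇒UpTrue⊎DownTrue ¬ftf a fa with UpTrue? a | DownTrue? a
  ... | yes up  | _        = inj₁ up
  ... | no _    | yes down = inj₂ down
  ... | no ¬up  | no ¬down =
    let y , a≤y , fy = ¬∀true⇒false (a ≤ₜ?_) ¬up
        x , x≤a , fx = ¬∀true⇒false (_≤ₜ? a) ¬down
    in contradiction (x , a , y , (x≤a , separated fx fa) , (a≤y , separated fy fa ∘ sym) , fx , fa , fy) ¬ftf
    where
    separated : ∀ {x y} → f x ≡ false → f y ≡ true → x ≢ y
    separated fx fy refl with trans (sym fx) fy
    ... | ()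

  Covered : Vec Bool n → Set
  Covered a = (∃ λ x → UpTrue x × x ≤ₜ a) ⊎ (∃ λ x → DownTrue x × a ≤ₜ x)

  ¬FTF⇒true⇔covered : ¬FTF f → ∀ a → f a ≡ true ⇔ Covered a
  ¬FTF⇒true⇔covered ¬ftf a = mk⇔
    (λ fa → [ (λ up → inj₁ (a , up , ≤ₜ-refl)) , (λ down → inj₂ (a , down , ≤ₜ-refl)) ]′
              (¬FTF⇒UpTrue⊎DownTrue ¬ftf a fa))
    [ (λ (x , up , x≤a) → up a x≤a) , (λ (x , down , a≤x) → down a a≤x) ]′

  monotone⇒¬DownTrue : Monotone f → NonConstant f → ∀ x → ¬ DownTrue x
  monotone⇒¬DownTrue mono nc x down with trans (sym (down _ (falses-≤ₜ x))) (monotone-falses f mono nc)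
  ... | ()

trueIndices falseIndices : Vec Bool n → List (Fin n)
trueIndices []          = []
trueIndices (true ∷ x)  = zero ∷ mapˡ suc (trueIndices x)
trueIndices (false ∷ x) = mapˡ suc (trueIndices x)
falseIndices []          = []
falseIndices (true ∷ x)  = mapˡ suc (falseIndices x)
falseIndices (false ∷ x) = zero ∷ mapˡ suc (falseIndices x)

trueIndices-≤ₜ : (x a : Vec Bool n) → Allˡ (λ i → lookup a i ≡ true) (trueIndices x) ⇔ x ≤ₜ a
trueIndices-≤ₜ x a = mk⇔ (All⇒≤ₜ x a) (≤ₜ⇒All x a)
  where
  All⇒≤ₜ : ∀ {n} (x a : Vec Bool n) → Allˡ (λ i → lookup a i ≡ true) (trueIndices x) → x ≤ₜ a
  All⇒≤ₜ []          []          _            = []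
  All⇒≤ₜ (true ∷ x)  (.true ∷ a) (refl ∷ all) = b≤b ∷ All⇒≤ₜ x a (Allˡₚ.map⁻ all)
  All⇒≤ₜ (false ∷ x) (y ∷ a)     all          = Boolₚ.≤-minimum y ∷ All⇒≤ₜ x a (Allˡₚ.map⁻ all)
  ≤ₜ⇒All : ∀ {n} (x a : Vec Bool n) → x ≤ₜ a → Allˡ (λ i → lookup a i ≡ true) (trueIndices x)
  ≤ₜ⇒All []          []          []         = []
  ≤ₜ⇒All (true ∷ x)  (.true ∷ a) (b≤b ∷ le) = refl ∷ Allˡₚ.map⁺ (≤ₜ⇒All x a le)
  ≤ₜ⇒All (false ∷ x) (_ ∷ a)     (_ ∷ le)   = Allˡₚ.map⁺ (≤ₜ⇒All x a le)

falseIndices-≥ₜ : (x a : Vec Bool n) → Allˡ (λ i → lookup a i ≡ false) (falseIndices x) ⇔ a ≤ₜ x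
falseIndices-≥ₜ x a = mk⇔ (All⇒≥ₜ x a) (≥ₜ⇒All x a)
  where
  All⇒≥ₜ : ∀ {n} (x a : Vec Bool n) → Allˡ (λ i → lookup a i ≡ false) (falseIndices x) → a ≤ₜ x
  All⇒≥ₜ []          []           _            = []
  All⇒≥ₜ (false ∷ x) (.false ∷ a) (refl ∷ all) = b≤b ∷ All⇒≥ₜ x a (Allˡₚ.map⁻ all)
  All⇒≥ₜ (true ∷ x)  (y ∷ a)      all          = Boolₚ.≤-maximum y ∷ All⇒≥ₜ x a (Allˡₚ.map⁻ all)
  ≥ₜ⇒All : ∀ {n} (x a : Vec Bool n) → a ≤ₜ x → Allˡ (λ i → lookup a i ≡ false) (falseIndices x)
  ≥ₜ⇒All []          []           []         = []
  ≥ₜ⇒All (false ∷ x) (.false ∷ a) (b≤b ∷ le) = refl ∷ Allˡₚ.map⁺ (≥ₜ⇒All x a le)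
  ≥ₜ⇒All (true ∷ x)  (_ ∷ a)      (_ ∷ le)   = Allˡₚ.map⁺ (≥ₜ⇒All x a le)

Any-mapMaybe-fromList : {A : Set} {P : List A → Set} {Ls : List (List A)} → Allˡ (_≢ []) Ls →
                        Any (P ∘ toList) (mapMaybe fromList Ls) ⇔ Any P Ls
Any-mapMaybe-fromList []                        = mk⇔ (λ ()) (λ ())
Any-mapMaybe-fromList {Ls = [] ∷ _} (≢[] ∷ _) = contradiction refl ≢[]
Any-mapMaybe-fromList {P = P} {Ls = (_ ∷ _) ∷ Ls} (_ ∷ ≢[]s) = mk⇔
  (λ { (here p) → here p ; (there p) → there (to ih p) })
  (λ { (here p) → here p ; (there p) → there (from ih p) })
  where
  ih : Any (P ∘ toList) (mapMaybe fromList Ls) ⇔ Any P Ls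
  ih = Any-mapMaybe-fromList ≢[]s

Any-map⇔ : {A B : Set} {P : B → Set} {Q : A → Set} {g : A → B} →
           (∀ x → P (g x) ⇔ Q x) → ∀ xs → Any P (mapˡ g xs) ⇔ Any Q xs
Any-map⇔ P⇔Q xs = mk⇔ (Any.map (to (P⇔Q _)) ∘ Anyₚ.map⁻) (Anyₚ.map⁺ ∘ Any.map (from (P⇔Q _)))

-- mapMaybe fromList silently drops points with an empty index list; Any-terms
-- therefore requires that no point satisfying P has one.
terms : {P : Vec Bool n → Set} → Decidable P → (Vec Bool n → List (Fin n)) → List (List⁺ (Fin n))
terms P? indices = mapMaybe fromList (mapˡ indices (filter P? (allTuples _)))

Any-terms : {P : Vec Bool n → Set} (P? : Decidable P) (indices : Vec Bool n → List (Fin n))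
            {Q : Fin n → Set} → (∀ x → P x → indices x ≢ []) →
            Any (Allˡ Q ∘ toList) (terms P? indices) ⇔ ∃ λ x → P x × Allˡ Q (indices x)
Any-terms P? indices {Q} nonEmpty = ⇔-trans (Any-mapMaybe-fromList {P = Allˡ Q} indices≢[])
  (⇔-trans (mk⇔ Anyₚ.map⁻ Anyₚ.map⁺) (Any-filter-allTuples P?))
  where
  indices≢[] : Allˡ (_≢ []) (mapˡ indices (filter P? (allTuples _)))
  indices≢[] = Allˡₚ.map⁺ (Allˡ.map (λ {x} → nonEmpty x) (Allˡₚ.all-filter P? (allTuples _)))

-- Semantics of the normal-form shapes

module _ (v : V → Bool) (β : Bool) {_⊕_ : Form V → Form V → Form V} where

  bigOp-Any : (∀ {A B} → ⟦ A ⊕ B ⟧ v ≡ β ⇔ (⟦ A ⟧ v ≡ β ⊎ ⟦ B ⟧ v ≡ β)) →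
              ∀ A As → ⟦ bigOp' _⊕_ A As ⟧ v ≡ β ⇔ Any (λ A → ⟦ A ⟧ v ≡ β) (A ∷ As)
  bigOp-Any ⊕-sem A []       = mk⇔ here λ { (here e) → e ; (there ()) }
  bigOp-Any ⊕-sem A (B ∷ Bs) = mk⇔
    (λ e → [ here , there ∘ to ih ]′ (to ⊕-sem e))
    (λ { (here e) → from ⊕-sem (inj₁ e) ; (there e) → from ⊕-sem (inj₂ (from ih e)) })
    where
    ih : ⟦ bigOp' _⊕_ B Bs ⟧ v ≡ β ⇔ Any (λ A → ⟦ A ⟧ v ≡ β) (B ∷ Bs)
    ih = bigOp-Any ⊕-sem B Bs

  bigOp-All : (∀ {A B} → ⟦ A ⊕ B ⟧ v ≡ β ⇔ (⟦ A ⟧ v ≡ β × ⟦ B ⟧ v ≡ β)) →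
              ∀ A As → ⟦ bigOp' _⊕_ A As ⟧ v ≡ β ⇔ Allˡ (λ A → ⟦ A ⟧ v ≡ β) (A ∷ As)
  bigOp-All ⊕-sem A []       = mk⇔ (_∷ []) λ { (e ∷ []) → e }
  bigOp-All ⊕-sem A (B ∷ Bs) = mk⇔
    (λ e → let eA , eB = to ⊕-sem e in eA ∷ to ih eB)
    (λ { (eA ∷ eB) → from ⊕-sem (eA , from ih eB) })
    where
    ih : ⟦ bigOp' _⊕_ B Bs ⟧ v ≡ β ⇔ Allˡ (λ A → ⟦ A ⟧ v ≡ β) (B ∷ Bs)
    ih = bigOp-All ⊕-sem B Bs

-- β is absorbing for ⊕ and neutral for ⊗: β = true with (∨, ∧) for DNFshape,
-- β = false with (∧, ∨) for CNFshape.
module _ (v : V → Bool) (β : Bool) {_⊕_ _⊗_ : Form V → Form V → Form V}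
         (⊕-sem : ∀ {A B} → ⟦ A ⊕ B ⟧ v ≡ β ⇔ (⟦ A ⟧ v ≡ β ⊎ ⟦ B ⟧ v ≡ β))
         (⊗-sem : ∀ {A B} → ⟦ A ⊗ B ⟧ v ≡ β ⇔ (⟦ A ⟧ v ≡ β × ⟦ B ⟧ v ≡ β)) where

  posTerm-≡ : ∀ c → ⟦ bigOp _⊗_ (posLits c) ⟧ v ≡ β ⇔ Allˡ (λ i → v i ≡ β) (toList c)
  posTerm-≡ (i ∷ is) = ⇔-trans (bigOp-All v β ⊗-sem (var i) (mapˡ var is)) (mk⇔ Allˡₚ.map⁻ Allˡₚ.map⁺)

  negTerm-≡ : ∀ c → ⟦ bigOp _⊗_ (negLits c) ⟧ v ≡ β ⇔ Allˡ (λ i → v i ≡ not β) (toList c)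
  negTerm-≡ (i ∷ is) = ⇔-trans (bigOp-All v β ⊗-sem (¬f var i) (mapˡ (λ j → ¬f var j) is))
    (mk⇔ (Allˡ.map (to not-≡⇔) ∘ Allˡₚ.map⁻) (Allˡₚ.map⁺ ∘ Allˡ.map (from not-≡⇔)))

  termList-≡ : ∀ ps qs → Any (λ A → ⟦ A ⟧ v ≡ β)
                 (mapˡ (λ c → bigOp _⊗_ (posLits c)) ps ++ mapˡ (λ c → bigOp _⊗_ (negLits c)) qs) ⇔
               (Any (Allˡ (λ i → v i ≡ β) ∘ toList) ps ⊎ Any (Allˡ (λ i → v i ≡ not β) ∘ toList) qs)
  termList-≡ ps qs = ⇔-trans (⇔-sym (↔⇒⇔ Anyₚ.++↔)) (Any-map⇔ posTerm-≡ ps ⊎-⇔ Any-map⇔ negTerm-≡ qs)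

  shape-≡ : ∀ ps qs → 0 < length ps + length qs →
            ⟦ shape _⊕_ _⊗_ ps qs ⟧ v ≡ β ⇔
            (Any (Allˡ (λ i → v i ≡ β) ∘ toList) ps ⊎ Any (Allˡ (λ i → v i ≡ not β) ∘ toList) qs)
  shape-≡ []       []       ()
  shape-≡ (c ∷ ps) qs       _ = ⇔-trans (bigOp-Any v β ⊕-sem _ _) (termList-≡ (c ∷ ps) qs)
  shape-≡ []       (c ∷ qs) _ = ⇔-trans (bigOp-Any v β ⊕-sem _ _) (termList-≡ [] (c ∷ qs))

DNFshape-true : (v : V → Bool) (ps qs : List (List⁺ V)) → 0 < length ps + length qs →
                ⟦ DNFshape ps qs ⟧ v ≡ true ⇔
                (Any (Allˡ (λ i → v i ≡ true) ∘ toList) ps ⊎ Any (Allˡ (λ i → v i ≡ false) ∘ toList) qs)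
DNFshape-true v = shape-≡ v true ∨-≡-true ∧-≡-true

CNFshape-false : (v : V → Bool) (ps qs : List (List⁺ V)) → 0 < length ps + length qs →
                 ⟦ CNFshape ps qs ⟧ v ≡ false ⇔
                 (Any (Allˡ (λ i → v i ≡ false) ∘ toList) ps ⊎ Any (Allˡ (λ i → v i ≡ true) ∘ toList) qs)
CNFshape-false v = shape-≡ v false ∧-≡-false ∨-≡-false

CNFshape-dual : (v : V → Bool) (ps qs : List (List⁺ V)) → 0 < length ps + length qs →
                ⟦ CNFshape qs ps ⟧ v ≡ not (⟦ DNFshape ps qs ⟧ v)
CNFshape-dual v ps qs nonEmpty = Boolₚ.⇔→≡
  (⇔-trans (CNFshape-false v qs ps (subst (0 <_) (+-comm (length ps) _) nonEmpty))
  (⇔-trans (mk⇔ ⊎-swap ⊎-swap)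
  (⇔-trans (⇔-sym (DNFshape-true v ps qs nonEmpty)) (⇔-sym not-≡⇔))))

AndOr-bigOp' : {_⊕_ : Form V → Form V → Form V} → (∀ {A B} → AndOr A → AndOr B → AndOr (A ⊕ B)) →
               ∀ {A As} → AndOr A → Allˡ AndOr As → AndOr (bigOp' _⊕_ A As)
AndOr-bigOp' ⊕-andOr andOrA []              = andOrA
AndOr-bigOp' ⊕-andOr andOrA (andOrB ∷ rest) = ⊕-andOr andOrA (AndOr-bigOp' ⊕-andOr andOrB rest)

AndOr-positiveTerm : (c : List⁺ V) → AndOr (bigOp _∧f_ (posLits c))
AndOr-positiveTerm (i ∷ is) = AndOr-bigOp' and (var i) (Allˡₚ.map⁺ (Allˡ.universal var is))

AndOr-positiveDNF : (ps : List (List⁺ V)) → 0 < length ps → AndOr (DNFshape ps [])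
AndOr-positiveDNF (c ∷ ps) _ = AndOr-bigOp' or (AndOr-positiveTerm c)
  (Allˡₚ.++⁺ (Allˡₚ.map⁺ (Allˡ.universal AndOr-positiveTerm ps)) [])

∃×-cong : {A : Set} {P Q R : A → Set} → (∀ x → Q x ⇔ R x) → (∃ λ x → P x × Q x) ⇔ (∃ λ x → P x × R x)
∃×-cong Q⇔R = mk⇔ (λ (x , px , qx) → x , px , to (Q⇔R x) qx) (λ (x , px , rx) → x , px , from (Q⇔R x) rx)

Any⊎Any⇒0<length : {A : Set} {P Q : A → Set} {xs ys : List A} → Any P xs ⊎ Any Q ys → 0 < length xs + length ys
Any⊎Any⇒0<length {xs = _ ∷ _} _                = s≤s z≤n
Any⊎Any⇒0<length {xs = []}    (inj₂ (here _))  = s≤s z≤n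
Any⊎Any⇒0<length {xs = []}    (inj₂ (there _)) = s≤s z≤n

module _ (f : BoolFun n) where

  upTerms downTerms : List (List⁺ (Fin n))
  upTerms   = terms (UpTrue? f) trueIndices
  downTerms = terms (DownTrue? f) falseIndices

  upTerms-cover : NonConstant f → ∀ a →
                  Any (Allˡ (λ i → lookup a i ≡ true) ∘ toList) upTerms ⇔ ∃ λ x → UpTrue f x × x ≤ₜ a
  upTerms-cover nc a = ⇔-trans (Any-terms (UpTrue? f) trueIndices nonEmpty) (∃×-cong λ x → trueIndices-≤ₜ x a)
    where
    nonEmpty : ∀ x → UpTrue f x → trueIndices x ≢ []
    nonEmpty x up empty = nc (constant f true λ b →
      up b (to (trueIndices-≤ₜ x b) (subst (Allˡ (λ i → lookup b i ≡ true)) (sym empty) [])))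

  downTerms-cover : NonConstant f → ∀ a →
                    Any (Allˡ (λ i → lookup a i ≡ false) ∘ toList) downTerms ⇔ ∃ λ x → DownTrue f x × a ≤ₜ x
  downTerms-cover nc a = ⇔-trans (Any-terms (DownTrue? f) falseIndices nonEmpty) (∃×-cong λ x → falseIndices-≥ₜ x a)
    where
    nonEmpty : ∀ x → DownTrue f x → falseIndices x ≢ []
    nonEmpty x down empty = nc (constant f true λ b →
      down b (to (falseIndices-≥ₜ x b) (subst (Allˡ (λ i → lookup b i ≡ false)) (sym empty) [])))

  ¬FTF⇒DNF : NonConstant f → ¬FTF f →
             0 < length upTerms + length downTerms × f ≈F DNFshape upTerms downTerms
  ¬FTF⇒DNF nc ¬ftf = nonEmpty , λ a →
    Boolₚ.⇔→≡ (⇔-trans (true⇔terms a) (⇔-sym (DNFshape-true (lookup a) upTerms downTerms nonEmpty)))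
    where
    true⇔terms : ∀ a → f a ≡ true ⇔ (Any (Allˡ (λ i → lookup a i ≡ true) ∘ toList) upTerms ⊎
                                      Any (Allˡ (λ i → lookup a i ≡ false) ∘ toList) downTerms)
    true⇔terms a = ⇔-trans (¬FTF⇒true⇔covered f ¬ftf a) (⇔-sym (upTerms-cover nc a ⊎-⇔ downTerms-cover nc a))
    nonEmpty : 0 < length upTerms + length downTerms
    nonEmpty = let a , fa = nonConstant⇒true f nc in Any⊎Any⇒0<length (to (true⇔terms a) fa)

  monotone⇒downTerms≡[] : Monotone f → NonConstant f → downTerms ≡ []
  monotone⇒downTerms≡[] mono nc
    rewrite filter-none (DownTrue? f) (Allˡ.universal (monotone⇒¬DownTrue f mono nc) (allTuples n)) = refl

  monotone⇒∧∨-form : Monotone f → NonConstant f → Σ (Form (Fin n)) λ F → AndOr F × f ≈F F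
  monotone⇒∧∨-form mono nc =
    let nonEmpty , f≈F = subst (λ qs → 0 < length upTerms + length qs × f ≈F DNFshape upTerms qs)
                               (monotone⇒downTerms≡[] mono nc) (¬FTF⇒DNF nc (monotone⇒¬FTF f mono))
    in DNFshape upTerms [] , AndOr-positiveDNF upTerms (subst (0 <_) (+-identityʳ _) nonEmpty) , f≈F

  monotone⇒diagonal≅p₁ : Monotone f → NonConstant f → (f [ replicate n p₁ ]) ≅ p₁
  monotone⇒diagonal≅p₁ mono nc v = trans (cong f (map-replicate _ p₁ n)) (diagonal (v 0))
    where
    diagonal : ∀ b → f (replicate n b) ≡ b
    diagonal false = monotone-falses f mono nc
    diagonal true  = monotone-trues f mono nc

¬TFT⇒CNF : (f : BoolFun n) → NonConstant f → ¬TFT f →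
           Σ (List (List⁺ (Fin n))) λ ps → Σ (List (List⁺ (Fin n))) λ qs →
           0 < length ps + length qs × f ≈F CNFshape ps qs
¬TFT⇒CNF f nc ¬tft =
  let ps = upTerms (not ∘ f) ; qs = downTerms (not ∘ f)
      nonEmpty , notf≈DNF = ¬FTF⇒DNF (not ∘ f) (nonConstant-not f nc) (¬TFT⇒¬FTF-not f ¬tft)
  in qs , ps , subst (0 <_) (+-comm (length ps) _) nonEmpty ,
     λ a → trans (to not-≡⇔ (notf≈DNF a)) (sym (CNFshape-dual (lookup a) ps qs nonEmpty))

antiMonotone⇒¬∧∨-form : (f : BoolFun n) → AntiMonotone f → NonConstant f →
                        Σ (Form (Fin n)) λ F → AndOr F × f ≈F (¬f F)
antiMonotone⇒¬∧∨-form f anti nc =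
  let F , andOr , notf≈F = monotone⇒∧∨-form (not ∘ f) (antiMonotone⇒monotone-not f anti) (nonConstant-not f nc)
  in F , andOr , λ a → to not-≡⇔ (notf≈F a)

antiMonotone⇒diagonal≅¬p₁ : (f : BoolFun n) → AntiMonotone f → NonConstant f → (f [ replicate n p₁ ]) ≅ (¬f p₁)
antiMonotone⇒diagonal≅¬p₁ f anti nc v =
  to not-≡⇔ (monotone⇒diagonal≅p₁ (not ∘ f) (antiMonotone⇒monotone-not f anti) (nonConstant-not f nc) v)

-- Substitutions along a chain a ≤ b ≤ c

select : {A : Set} → Bool → Bool → A → A → A → A
select x y a b c = if x then c else if y then b else a

column : {A : Set} → A → A → A → A → Bool → Bool → Bool → A
column ⊥ ⊤ X Y true  _     _     = ⊤
column ⊥ ⊤ X Y false true  _     = Y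
column ⊥ ⊤ X Y false false true  = X
column ⊥ ⊤ X Y false false false = ⊥

chainSubst : {A : Set} → A → A → A → A → Vec Bool n → Vec Bool n → Vec Bool n → Vec A n
chainSubst ⊥ ⊤ X Y []      []      []      = []
chainSubst ⊥ ⊤ X Y (p ∷ a) (q ∷ b) (r ∷ c) = column ⊥ ⊤ X Y p q r ∷ chainSubst ⊥ ⊤ X Y a b c

map-chainSubst : {A B : Set} (g : A → B) {⊥ ⊤ X Y : A} (a b c : Vec Bool n) →
                 map g (chainSubst ⊥ ⊤ X Y a b c) ≡ chainSubst (g ⊥) (g ⊤) (g X) (g Y) a b c
map-chainSubst g []      []      []      = refl
map-chainSubst g (p ∷ a) (q ∷ b) (r ∷ c) = cong₂ _∷_ (map-column p q r) (map-chainSubst g a b c)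
  where
  map-column : ∀ p q r → g (column _ _ _ _ p q r) ≡ column _ _ _ _ p q r
  map-column true  _     _     = refl
  map-column false true  _     = refl
  map-column false false true  = refl
  map-column false false false = refl

column-select : ∀ {x y p q r} → x ≤ᵇ y → p ≤ᵇ q → q ≤ᵇ r → column false true x y p q r ≡ select x y p q r
column-select {false} {false} {true}  {true}  {true}  _ _ _ = refl
column-select {false} {false} {false} {true}  {true}  _ _ _ = refl
column-select {false} {false} {false} {false} {true}  _ _ _ = refl
column-select {false} {false} {false} {false} {false} _ _ _ = refl
column-select {false} {true}  {true}  {true}  {true}  _ _ _ = refl
column-select {false} {true}  {false} {true}  {true}  _ _ _ = refl
column-select {false} {true}  {false} {false} {true}  _ _ _ = refl
column-select {false} {true}  {false} {false} {false} _ _ _ = refl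
column-select {true}  {true}  {true}  {true}  {true}  _ _ _ = refl
column-select {true}  {true}  {false} {true}  {true}  _ _ _ = refl
column-select {true}  {true}  {false} {false} {true}  _ _ _ = refl
column-select {true}  {true}  {false} {false} {false} _ _ _ = refl
column-select {true}  {false} ()
column-select {_} {_} {true}  {false} _ ()
column-select {_} {_} {_}     {true}  {false} _ _ ()

chainSubst-select : ∀ {x y} {a b c : Vec Bool n} → x ≤ᵇ y → a ≤ₜ b → b ≤ₜ c →
                    chainSubst false true x y a b c ≡ select x y a b c
chainSubst-select {x = x} {y} x≤y [] [] = select-[] x y
  where
  select-[] : ∀ x y → [] ≡ select x y [] [] []
  select-[] true  _     = refl
  select-[] false true  = refl
  select-[] false false = refl
chainSubst-select {x = x} {y} x≤y (p≤q ∷ a≤b) (q≤r ∷ b≤c) =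
  trans (cong₂ _∷_ (column-select x≤y p≤q q≤r) (chainSubst-select x≤y a≤b b≤c)) (select-∷ x y)
  where
  select-∷ : ∀ {A : Set} {p q r : A} {a b c : Vec A n} x y →
             select x y p q r ∷ select x y a b c ≡ select x y (p ∷ a) (q ∷ b) (r ∷ c)
  select-∷ true  _     = refl
  select-∷ false true  = refl
  select-∷ false false = refl

chainSubst-All : {A : Set} {P : A → Set} {⊥ ⊤ X Y : A} → P ⊥ → P ⊤ → P X → P Y →
                 (a b c : Vec Bool n) → All P (chainSubst ⊥ ⊤ X Y a b c)
chainSubst-All P⊥ P⊤ PX PY []      []      []      = []
chainSubst-All {P = P} P⊥ P⊤ PX PY (p ∷ a) (q ∷ b) (r ∷ c) = P-column p q r ∷ chainSubst-All P⊥ P⊤ PX PY a b c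
  where
  P-column : ∀ p q r → P (column _ _ _ _ p q r)
  P-column true  _     _     = P⊤
  P-column false true  _     = PY
  P-column false false true  = PX
  P-column false false false = P⊥

chainSubst-eval : (f : BoolFun n) {X Y : Form V} {a b c : Vec Bool n} (v : V → Bool) →
                  ⟦ X ⟧ v ≤ᵇ ⟦ Y ⟧ v → a ≤ₜ b → b ≤ₜ c →
                  (f [ chainSubst ⊥f ⊤f X Y a b c ]) v ≡ f (select (⟦ X ⟧ v) (⟦ Y ⟧ v) a b c)
chainSubst-eval f {a = a} {b} {c} v X≤Y a≤b b≤c =
  cong f (trans (map-chainSubst (λ A → ⟦ A ⟧ v) a b c) (chainSubst-select X≤Y a≤b b≤c))

TFT⇒implication : (f : BoolFun n) → TFT f → Σ (Vec (Form ℕ) n) λ As →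
                  All (λ A → A ∈ (p₁ ∷ p₂ ∷ (p₁ ∨f p₂) ∷ ⊥f ∷ ⊤f ∷ [])) As × (f [ As ]) ≅ (p₁ ⇒f p₂)
TFT⇒implication f (a , b , c , (a≤b , _) , (b≤c , _) , fa , fb , fc) =
  chainSubst ⊥f ⊤f p₂ (p₁ ∨f p₂) a b c ,
  chainSubst-All (there (there (there (here refl)))) (there (there (there (there (here refl)))))
                 (there (here refl)) (there (there (here refl))) a b c ,
  λ v → trans (chainSubst-eval f v (y≤x∨y (v 0) (v 1)) a≤b b≤c) (selected (v 0) (v 1))
  where
  selected : ∀ x y → f (select y (x ∨ y) a b c) ≡ not x ∨ y
  selected x     true  = trans fc (sym (Boolₚ.∨-zeroʳ (not x)))
  selected true  false = fb
  selected false false = fa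

FTF⇒difference : (f : BoolFun n) → FTF f → Σ (Vec (Form ℕ) n) λ As →
                 All (λ A → A ∈ (p₁ ∷ p₂ ∷ (p₁ ∧f p₂) ∷ ⊥f ∷ ⊤f ∷ [])) As × (f [ As ]) ≅ (p₁ ∧f (¬f p₂))
FTF⇒difference f (a , b , c , (a≤b , _) , (b≤c , _) , fa , fb , fc) =
  chainSubst ⊥f ⊤f (p₁ ∧f p₂) p₁ a b c ,
  chainSubst-All (there (there (there (here refl)))) (there (there (there (there (here refl)))))
                 (there (there (here refl))) (here refl) a b c ,
  λ v → trans (chainSubst-eval f v (x∧y≤x (v 0) (v 1)) a≤b b≤c) (selected (v 0) (v 1))
  where
  selected : ∀ x y → f (select (x ∧ y) x a b c) ≡ x ∧ not y
  selected true  true  = fc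
  selected true  false = fb
  selected false _     = fa

rest⇒identity-and-negation : (f : BoolFun n) → Rest f →
  Σ (Vec (Form ℕ) n) λ Bs → Σ (Vec (Form ℕ) n) λ Cs →
  All (λ A → A ∈ (p₁ ∷ ⊥f ∷ ⊤f ∷ [])) Bs × All (λ A → A ∈ (p₁ ∷ ⊥f ∷ ⊤f ∷ [])) Cs ×
  (f [ Bs ]) ≅ p₁ × (f [ Cs ]) ≅ (¬f p₁)
rest⇒identity-and-negation f (¬mono , ¬anti) =
  let a , b , a≤b , fa , fb = ¬antiMonotone⇒witness f ¬anti
      c , d , c≤d , fc , fd = ¬monotone⇒witness f ¬mono
  in chainSubst ⊥f ⊤f p₁ p₁ a b b , chainSubst ⊥f ⊤f p₁ p₁ c d d ,
     members a b , members c d ,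
     (λ v → trans (chainSubst-eval f v Boolₚ.≤-refl a≤b ≤ₜ-refl) (selected id fa fb (v 0))) ,
     (λ v → trans (chainSubst-eval f v Boolₚ.≤-refl c≤d ≤ₜ-refl) (selected not fc fd (v 0)))
  where
  members : (a b : Vec Bool n) → All (λ A → A ∈ (p₁ ∷ ⊥f ∷ ⊤f ∷ [])) (chainSubst ⊥f ⊤f p₁ p₁ a b b)
  members a b = chainSubst-All (there (here refl)) (there (there (here refl))) (here refl) (here refl) a b b
  selected : ∀ (g : Bool → Bool) {a b} → f a ≡ g false → f b ≡ g true → ∀ x → f (select x x a b b) ≡ g x
  selected g fa fb true  = fb
  selected g fa fb false = fa

lemma1 : (n : ℕ) (f : BoolFun n) →
    (Monotone f → NonConstant f →
      Σ (Form (Fin n)) λ F → AndOr F × f ≈F F)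
  × (Monotone f → NonConstant f → (f [ replicate n p₁ ]) ≅ p₁)
  × (AntiMonotone f → NonConstant f →
      Σ (Form (Fin n)) λ F → AndOr F × f ≈F (¬f F))
  × (AntiMonotone f → NonConstant f → (f [ replicate n p₁ ]) ≅ (¬f p₁))
  × (TFT f → Σ (Vec (Form ℕ) n) λ As →
      All (λ A → A ∈ (p₁ ∷ p₂ ∷ (p₁ ∨f p₂) ∷ ⊥f ∷ ⊤f ∷ [])) As
      × (f [ As ]) ≅ (p₁ ⇒f p₂))
  × (FTF f → Σ (Vec (Form ℕ) n) λ As →
      All (λ A → A ∈ (p₁ ∷ p₂ ∷ (p₁ ∧f p₂) ∷ ⊥f ∷ ⊤f ∷ [])) As
      × (f [ As ]) ≅ (p₁ ∧f (¬f p₂)))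
  × (Rest f → Σ (Vec (Form ℕ) n) λ Bs → Σ (Vec (Form ℕ) n) λ Cs →
      All (λ A → A ∈ (p₁ ∷ ⊥f ∷ ⊤f ∷ [])) Bs
      × All (λ A → A ∈ (p₁ ∷ ⊥f ∷ ⊤f ∷ [])) Cs
      × (f [ Bs ]) ≅ p₁ × (f [ Cs ]) ≅ (¬f p₁))
  × (NonConstant f → ¬FTF f →
      Σ (List (List⁺ (Fin n))) λ ps → Σ (List (List⁺ (Fin n))) λ qs →
      0 < length ps + length qs × f ≈F DNFshape ps qs)
  × (NonConstant f → ¬TFT f →
      Σ (List (List⁺ (Fin n))) λ ps → Σ (List (List⁺ (Fin n))) λ qs →
      0 < length ps + length qs × f ≈F CNFshape ps qs)
lemma1 n f =
    monotone⇒∧∨-form f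
  , monotone⇒diagonal≅p₁ f
  , antiMonotone⇒¬∧∨-form f
  , antiMonotone⇒diagonal≅¬p₁ f
  , TFT⇒implication f
  , FTF⇒difference f
  , rest⇒identity-and-negation f
  , (λ nc ¬ftf → upTerms f , downTerms f , ¬FTF⇒DNF f nc ¬ftf)
  , ¬TFT⇒CNF f
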